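{- The variety $\mathsf{DHA}$ is canonical: for every $A\in\mathsf{DHA}$, the Heyting algebra $\mathrm{Up}(X_A)$ belongs to $\mathsf{DHA}$.
   Context: $X_A$ is the poset of prime filters of $A$ ordered by inclusion. For a poset $X$, $\mathrm{Up}(X)$ is the Heyting algebra of upsets of $X$ ($U\to V=\{x:{\uparrow}x\cap U\subseteq V\}$, ${\uparrow}x=\{y:x\le y\}$). A poset satisfies the three point rule if for all distinct $x,y,z$, if $x,y$ are incomparable and $x\le z$ then $y\le z$. A poset $X$ is a diamond system if: (D1) each ${\uparrow}x$ satisfies the three point rule; (D2) no ${\uparrow}x$ contains a $3$-element antichain; (D3) for all $x$ and $y,z\in{\uparrow}x$ there is $w$ with $y,z\le w$; (D4) whenever $\bot\le x,y$, $x,y\le z,v$, $z,v\le\top$, there is $w$ with $x,y\le w\le z,v$. A diamond sequence is a diamond system in which any two elements have a common lower bound. $\mathsf{DHA}$ is the variety generated by $\{\mathrm{Up}(X): X$ a finite diamond sequence$\}$. -}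

module Defs where

open import Level using (Level; _⊔_; 0ℓ) renaming (suc to lsuc)
open import Data.Nat using (ℕ)
open import Data.Fin using (Fin)
open import Data.Product using (Σ; ∃; _×_; _,_; proj₁)
open import Data.Sum using (_⊎_)
open import Data.Unit.Polymorphic using () renaming (⊤ to ⊤ₚ)
open import Data.Empty.Polymorphic using () renaming (⊥ to ⊥ₚ)
open import Relation.Nullary using (¬_)
open import Relation.Binary.PropositionalEquality using (_≡_)
open import Relation.Binary.Structures using (IsPartialOrder)
open import Relation.Binary.Lattice.Bundles using (HeytingAlgebra)

data Term : Set where
  var      : ℕ → Term
  top bot  : Term
  _and_ _or_ _imp_ : Term → Term → Term

Equation : Set
Equation = Term × Term

module _ {c ℓ₁ ℓ₂} (A : HeytingAlgebra c ℓ₁ ℓ₂) where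
  open HeytingAlgebra A

  evalHA : (ℕ → Carrier) → Term → Carrier
  evalHA ρ (var i)   = ρ i
  evalHA ρ top       = ⊤
  evalHA ρ bot       = ⊥
  evalHA ρ (s and t) = evalHA ρ s ∧ evalHA ρ t
  evalHA ρ (s or t)  = evalHA ρ s ∨ evalHA ρ t
  evalHA ρ (s imp t) = evalHA ρ s ⇨ evalHA ρ t

  HA⊨ : Equation → Set (c ⊔ ℓ₁)
  HA⊨ (s , t) = (ρ : ℕ → Carrier) → evalHA ρ s ≈ evalHA ρ t

-- The Heyting algebra Up(X) of upsets of a poset X, written out:
-- an upset is a predicate on X closed upwards; two upsets are equal
-- iff they have the same elements; meet = ∩, join = ∪, top = X,
-- bottom = ∅, and  U → V = { x : ↑x ∩ U ⊆ V }.

module _ {a r : Level} (X : Set a) (_≤_ : X → X → Set r) where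

  L : Level
  L = a ⊔ r

  IsUpset : (X → Set L) → Set L
  IsUpset U = ∀ {x y} → x ≤ y → U x → U y

  evalUp : (ℕ → X → Set L) → Term → X → Set L
  evalUp v (var i)   x = v i x
  evalUp v top       x = ⊤ₚ
  evalUp v bot       x = ⊥ₚ
  evalUp v (s and t) x = evalUp v s x × evalUp v t x
  evalUp v (s or t)  x = evalUp v s x ⊎ evalUp v t x
  evalUp v (s imp t) x = ∀ y → x ≤ y → evalUp v s y → evalUp v t y

  Up⊨ : Equation → Set (lsuc L)
  Up⊨ (s , t) = (v : ℕ → X → Set L) → (∀ i → IsUpset (v i)) →
                ∀ x → (evalUp v s x → evalUp v t x) × (evalUp v t x → evalUp v s x)

module _ {a r : Level} {X : Set a} (_≤_ : X → X → Set r) where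

  Incomparable : X → X → Set r
  Incomparable x y = ¬ (x ≤ y) × ¬ (y ≤ x)

  D1 : Set (a ⊔ r)
  D1 = ∀ x p q s → x ≤ p → x ≤ q → x ≤ s →
       ¬ (p ≡ q) → ¬ (p ≡ s) → ¬ (q ≡ s) →
       Incomparable p q → p ≤ s → q ≤ s

  D2 : Set (a ⊔ r)
  D2 = ∀ x p q s → x ≤ p → x ≤ q → x ≤ s →
       ¬ (Incomparable p q × Incomparable p s × Incomparable q s)

  D3 : Set (a ⊔ r)
  D3 = ∀ x y z → x ≤ y → x ≤ z → ∃ λ w → y ≤ w × z ≤ w

  D4 : Set (a ⊔ r)
  D4 = ∀ b x y z v t → b ≤ x → b ≤ y →
       x ≤ z → x ≤ v → y ≤ z → y ≤ v → z ≤ t → v ≤ t →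
       ∃ λ w → x ≤ w × y ≤ w × w ≤ z × w ≤ v

  IsDiamondSystem : Set (a ⊔ r)
  IsDiamondSystem = D1 × D2 × D3 × D4

  IsDiamondSequence : Set (a ⊔ r)
  IsDiamondSequence = IsDiamondSystem × (∀ x y → ∃ λ w → w ≤ x × w ≤ y)

-- A finite diamond sequence: a partial order on Fin n (every finite
-- poset is isomorphic to one of these) which is a diamond sequence.
record FiniteDiamondSequence : Set₁ where
  field
    size      : ℕ
    _≼_       : Fin size → Fin size → Set
    isPO      : IsPartialOrder _≡_ _≼_
    isDiamond : IsDiamondSequence _≼_

-- Equations valid in every Up(X), X a finite diamond sequence
-- (i.e. the equational theory of DHA)
ValidInDHA : Equation → Set₁
ValidInDHA e = (X : FiniteDiamondSequence) →
               Up⊨ (Fin (FiniteDiamondSequence.size X)) (FiniteDiamondSequence._≼_ X) e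

-- Membership of a Heyting algebra in the variety DHA (by Birkhoff's
-- HSP theorem: it satisfies every equation valid in the generators)
InDHA : ∀ {c ℓ₁ ℓ₂} → HeytingAlgebra c ℓ₁ ℓ₂ → Set (lsuc 0ℓ ⊔ c ⊔ ℓ₁)
InDHA A = (e : Equation) → ValidInDHA e → HA⊨ A e

UpInDHA : ∀ {a r} (X : Set a) (_≤_ : X → X → Set r) → Set (lsuc (a ⊔ r))
UpInDHA X _≤_ = (e : Equation) → ValidInDHA e → Up⊨ X _≤_ e

module _ {c ℓ₁ ℓ₂} (A : HeytingAlgebra c ℓ₁ ℓ₂) where
  open HeytingAlgebra A

  record IsPrimeFilter {p : Level} (F : Carrier → Set p) : Set (c ⊔ ℓ₂ ⊔ p) where
    field
      upClosed : ∀ {x y} → x ≤ y → F x → F y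
      hasTop   : F ⊤
      meetCl   : ∀ {x y} → F x → F y → F (x ∧ y)
      proper   : ¬ F ⊥
      prime    : ∀ {x y} → F (x ∨ y) → F x ⊎ F y

  PLevel : Level
  PLevel = c ⊔ ℓ₁ ⊔ ℓ₂

  PrimeFilter : Set (lsuc PLevel)
  PrimeFilter = Σ (Carrier → Set PLevel) IsPrimeFilter

  _⊆PF_ : PrimeFilter → PrimeFilter → Set PLevel
  (F , _) ⊆PF (G , _) = ∀ x → F x → G x

-- Classical ambient principles (ZFC-valid), assumed as hypotheses

PrimeFilterTheorem : ∀ c ℓ₁ ℓ₂ → Set (lsuc (c ⊔ ℓ₁ ⊔ ℓ₂))
PrimeFilterTheorem c ℓ₁ ℓ₂ = (A : HeytingAlgebra c ℓ₁ ℓ₂) →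
  let open HeytingAlgebra A in
  ∀ x y → ¬ (x ≤ y) → Σ (PrimeFilter A) λ F → proj₁ F x × ¬ proj₁ F y

-- Through the prime filter representation, an equation valid in A holds in Up(X_A) under every
-- admissible valuation F ↦ [a ∈ F]. Instantiating four laws of DHA at elements separating prime
-- filters, and using the prime filter theorem to produce the filters needed, shows that every
-- cone ↑x of X_A is a diamond frame: it obeys the three point rule, has width two, is directed
-- and has the interpolation property (D4). Now fix an arbitrary upset valuation and an equation.
-- A point of ↑x has at most one incomparable partner up to equivalence, so coding each point by
-- its type (which variables of the equation hold there) and the type of its partner maps ↑x by a
-- surjective bounded morphism onto a finite diamond sequence. Bounded morphisms and generated
-- subframes preserve truth, so the equation, valid in that finite quotient, holds at x.

module Submission where

open import Defs
open import Level using (Level; _⊔_; Lift; lift; lower; 0ℓ)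
open import Axiom.ExcludedMiddle using (ExcludedMiddle)
open import Axiom.DoubleNegationElimination using (em⇒dne)
open import Data.Bool using (Bool; true)
import Data.Bool as Bool
open import Data.Bool.Properties using (T-≡)
open import Data.Empty using (⊥-elim)
open import Data.Fin using (Fin; zero; suc; toℕ; fromℕ<)
open import Data.Fin.Properties using (toℕ-fromℕ<)
open import Data.Fin.Subset using (Subset; inside; outside; _∈_; _⊆_; _∪_; _∩_)
open import Data.Fin.Subset.Properties
  using (⊆-refl; ⊆-trans; ⊆-antisym; p⊆p∪q; q⊆p∪q; p∩q⊆p; p∩q⊆q; x∈p∪q⁻; x∈p∩q⁺)
open import Data.List
  using (List; []; _∷_; map; _++_; cartesianProduct; filter; deduplicate; length; lookup)
open import Data.List.Membership.Propositional using () renaming (_∈_ to _∈ˡ_)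
open import Data.List.Membership.Propositional.Properties
  using ( ∈-map⁺; ∈-++⁺ˡ; ∈-++⁺ʳ; ∈-cartesianProduct⁺; ∈-filter⁺; ∈-filter⁻
        ; ∈-deduplicate⁺; ∈-deduplicate⁻; ∈-lookup)
import Data.List.Relation.Unary.All as All
open import Data.List.Relation.Unary.AllPairs using (_∷_)
open import Data.List.Relation.Unary.Any using (here; index)
open import Data.List.Relation.Unary.Any.Properties using (lookup-index)
open import Data.List.Relation.Unary.Unique.Propositional using (Unique)
open import Data.List.Relation.Unary.Unique.DecPropositional.Properties using (deduplicate-!)
open import Data.Nat using (ℕ; zero; suc; _<_)
import Data.Nat as ℕ
open import Data.Nat.Properties using (m⊔n≤o⇒m≤o; m⊔n≤o⇒n≤o; m≤m⊔n; m≤n⊔m)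
open import Data.Product using (Σ; ∃; ∃₂; _×_; _,_; proj₁; proj₂; swap; uncurry)
open import Data.Product.Function.NonDependent.Propositional using (_×-⇔_)
open import Data.Product.Properties using () renaming (≡-dec to ×-≡-dec)
open import Data.Sum using (_⊎_; inj₁; inj₂; [_,_]′)
import Data.Sum as Sum
open import Data.Sum.Function.Propositional using (_⊎-⇔_)
open import Data.Unit using (tt) renaming (⊤ to Unit)
open import Data.Unit.Polymorphic using () renaming (tt to ttₚ)
open import Data.Vec using ([]; _∷_; tabulate)
open import Data.Vec.Properties
  using (lookup∘tabulate; []=⇒lookup; lookup⇒[]=) renaming (≡-dec to Vec-≡-dec)
open import Function using (_∘_; _on_; case_of_)
open import Function.Bundles using (_⇔_; mk⇔; Equivalence)
open import Function.Construct.Composition using (_⇔-∘_)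
open import Function.Construct.Identity using (⇔-id)
open import Function.Construct.Symmetry using (⇔-sym)
open import Relation.Binary.Core using (Rel)
open import Relation.Binary.Definitions using (Reflexive; Transitive; DecidableEquality)
open import Relation.Binary.Lattice.Bundles using (HeytingAlgebra)
import Relation.Binary.Lattice.Properties.HeytingAlgebra as HeytingAlgebraProperties
import Relation.Binary.Lattice.Properties.MeetSemilattice as MeetSemilatticeProperties
open import Relation.Binary.PropositionalEquality
  using (_≡_; refl; sym; trans; cong; cong₂; subst; subst₂)
import Relation.Binary.PropositionalEquality as ≡
open import Relation.Binary.Structures using (IsPartialOrder)
open import Relation.Nullary using (¬_; Dec; yes; no; isYes; contradiction)
open import Relation.Nullary.Decidable using (True; toWitness; fromWitness)

open Equivalence using (to; from)

module Classical (lem : (ℓ : Level) → ExcludedMiddle ℓ) where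

  dec : ∀ {ℓ} (P : Set ℓ) → Dec P
  dec {ℓ} P = lem ℓ

  dne : ∀ {ℓ} {P : Set ℓ} → ¬ ¬ P → P
  dne {ℓ} = em⇒dne (lem ℓ)

  module _ {a p q} {A : Set a} {P : A → Set p} {Q : A → Set q} where

    ¬∀→⇒∃×¬ : ¬ (∀ x → P x → Q x) → ∃ λ x → P x × ¬ Q x
    ¬∀→⇒∃×¬ h = dne λ ¬∃ → h λ x px → dne λ ¬qx → ¬∃ (x , px , ¬qx)

    ¬∀→→⇒∃××¬ : ∀ {r} {R : A → Set r} → ¬ (∀ x → P x → Q x → R x) → ∃ λ x → P x × Q x × ¬ R x
    ¬∀→→⇒∃××¬ h = dne λ ¬∃ → h λ x px qx → dne λ ¬rx → ¬∃ (x , px , qx , ¬rx)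

-- Bounded morphisms

VarsBelow : ℕ → Term → Set
VarsBelow n (var i)   = i < n
VarsBelow n top       = Unit
VarsBelow n bot       = Unit
VarsBelow n (s and t) = VarsBelow n s × VarsBelow n t
VarsBelow n (s or t)  = VarsBelow n s × VarsBelow n t
VarsBelow n (s imp t) = VarsBelow n s × VarsBelow n t

varBound : Term → ℕ
varBound (var i)   = suc i
varBound top       = 0
varBound bot       = 0
varBound (s and t) = varBound s ℕ.⊔ varBound t
varBound (s or t)  = varBound s ℕ.⊔ varBound t
varBound (s imp t) = varBound s ℕ.⊔ varBound t

varsBelow : ∀ t {n} → varBound t ℕ.≤ n → VarsBelow n t
varsBelow (var i)   le = le
varsBelow top       le = tt
varsBelow bot       le = tt
varsBelow (s and t) le = varsBelow s (m⊔n≤o⇒m≤o _ _ le) , varsBelow t (m⊔n≤o⇒n≤o _ _ le)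
varsBelow (s or t)  le = varsBelow s (m⊔n≤o⇒m≤o _ _ le) , varsBelow t (m⊔n≤o⇒n≤o _ _ le)
varsBelow (s imp t) le = varsBelow s (m⊔n≤o⇒m≤o _ _ le) , varsBelow t (m⊔n≤o⇒n≤o _ _ le)

module _ {a r b q} {X : Set a} {Y : Set b} (_≤X_ : Rel X r) (_≤Y_ : Rel Y q) where

  record IsBoundedMorphism (π : X → Y) : Set (a ⊔ r ⊔ b ⊔ q) where
    field
      forth : ∀ {x y} → x ≤X y → π x ≤Y π y
      back  : ∀ {x j} → π x ≤Y j → ∃ λ y → x ≤X y × π y ≡ j

  module _ {π : X → Y} (isBM : IsBoundedMorphism π) {n : ℕ}
           (v : ℕ → X → Set (L X _≤X_)) (w : ℕ → Y → Set (L Y _≤Y_))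
           (agree : ∀ {i} → i < n → ∀ x → v i x ⇔ w i (π x)) where
    open IsBoundedMorphism isBM

    ⟦_⟧X : Term → X → Set (L X _≤X_)
    ⟦_⟧X = evalUp X _≤X_ v

    ⟦_⟧Y : Term → Y → Set (L Y _≤Y_)
    ⟦_⟧Y = evalUp Y _≤Y_ w

    boundedMorphism-preserves : ∀ t → VarsBelow n t → ∀ x → ⟦ t ⟧X x ⇔ ⟦ t ⟧Y (π x)
    boundedMorphism-preserves (var i)   i<n         x = agree i<n x
    boundedMorphism-preserves top       _           x = mk⇔ (λ _ → ttₚ) (λ _ → ttₚ)
    boundedMorphism-preserves bot       _           x = mk⇔ (λ ()) (λ ())
    boundedMorphism-preserves (s and t) (s<n , t<n) x =
      boundedMorphism-preserves s s<n x ×-⇔ boundedMorphism-preserves t t<n x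
    boundedMorphism-preserves (s or t)  (s<n , t<n) x =
      boundedMorphism-preserves s s<n x ⊎-⇔ boundedMorphism-preserves t t<n x
    boundedMorphism-preserves (s imp t) (s<n , t<n) x = mk⇔ forward backward
      where
      preserves-s : ∀ y → ⟦ s ⟧X y ⇔ ⟦ s ⟧Y (π y)
      preserves-s = boundedMorphism-preserves s s<n
      preserves-t : ∀ y → ⟦ t ⟧X y ⇔ ⟦ t ⟧Y (π y)
      preserves-t = boundedMorphism-preserves t t<n
      forward : ⟦ s imp t ⟧X x → ⟦ s imp t ⟧Y (π x)
      forward s⇒t j πx≤j ⟦s⟧ with back πx≤j
      ... | y , x≤y , refl = to (preserves-t y) (s⇒t y x≤y (from (preserves-s y) ⟦s⟧))
      backward : ⟦ s imp t ⟧Y (π x) → ⟦ s imp t ⟧X x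
      backward s⇒t y x≤y ⟦s⟧ = from (preserves-t y) (s⇒t (π y) (forth x≤y) (to (preserves-s y) ⟦s⟧))

module _ {a r} {X : Set a} (_≤_ : Rel X r) (x₀ : X) where

  Above : Set (a ⊔ r)
  Above = Σ X (x₀ ≤_)

  _≤↑_ : Rel Above r
  _≤↑_ = _≤_ on proj₁

  inclusion-isBoundedMorphism : Transitive _≤_ → IsBoundedMorphism _≤↑_ _≤_ proj₁
  inclusion-isBoundedMorphism ≤-trans = record
    { forth = λ le → le
    ; back  = λ {(x , x₀≤x)} {y} x≤y → (y , ≤-trans x₀≤x x≤y) , x≤y , refl }

-- Diamond frames

module _ {a r} {X : Set a} (_≤_ : Rel X r) where

  record IsThreePointFrame : Set (a ⊔ r) where
    field
      ≤-refl      : Reflexive _≤_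
      ≤-trans     : Transitive _≤_
      threePoint  : ∀ {p q s} → Incomparable _≤_ p q → p ≤ s → ¬ s ≤ p → q ≤ s
      noAntichain : ∀ {p q s} → Incomparable _≤_ p q → Incomparable _≤_ p s → ¬ Incomparable _≤_ q s

  record IsDiamondFrame : Set (a ⊔ r) where
    field
      isThreePointFrame : IsThreePointFrame
      directed          : ∀ p q → ∃ λ w → p ≤ w × q ≤ w
      interpolate       : ∀ {p q r s} → Incomparable _≤_ p q → Incomparable _≤_ r s →
                          p ≤ r → p ≤ s → q ≤ r → q ≤ s → ∃ λ w → p ≤ w × q ≤ w × w ≤ r × w ≤ s
    open IsThreePointFrame isThreePointFrame public

module ThreePointFrame (lem : (ℓ : Level) → ExcludedMiddle ℓ)
                       {a r} {X : Set a} {_≤_ : Rel X r} (F : IsThreePointFrame _≤_) where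
  open Classical lem
  open IsThreePointFrame F

  incomparable-cong : ∀ {x y z} → x ≤ y → y ≤ x → Incomparable _≤_ x z → Incomparable _≤_ y z
  incomparable-cong x≤y y≤x (x≰z , z≰x) =
    (λ y≤z → x≰z (≤-trans x≤y y≤z)) , (λ z≤y → z≰x (≤-trans z≤y y≤x))

  partner-unique : ∀ {y z₁ z₂} → Incomparable _≤_ y z₁ → Incomparable _≤_ y z₂ → z₁ ≤ z₂
  partner-unique {y} {z₁} {z₂} y∥z₁ y∥z₂ with dec (z₁ ≤ z₂) | dec (z₂ ≤ z₁)
  ... | yes z₁≤z₂ | _         = z₁≤z₂
  ... | no z₁≰z₂  | yes z₂≤z₁ = contradiction (threePoint (swap y∥z₂) z₂≤z₁ z₁≰z₂) (proj₁ y∥z₁)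
  ... | no z₁≰z₂  | no z₂≰z₁  = ⊥-elim (noAntichain y∥z₁ y∥z₂ (z₁≰z₂ , z₂≰z₁))

  partner-above : ∀ {y z w} → y ≤ z → ¬ z ≤ y → Incomparable _≤_ z w → y ≤ w
  partner-above {y} {z} {w} y≤z z≰y z∥w with dec (y ≤ w) | dec (w ≤ y)
  ... | yes y≤w | _       = y≤w
  ... | no y≰w  | yes w≤y = contradiction (≤-trans w≤y y≤z) (proj₂ z∥w)
  ... | no y≰w  | no w≰y  = contradiction (threePoint (y≰w , w≰y) y≤z z≰y) (proj₂ z∥w)

  above-one-or-below-both : ∀ {r s} g → Incomparable _≤_ r s → r ≤ g ⊎ s ≤ g ⊎ (g ≤ r × g ≤ s)
  above-one-or-below-both {r} {s} g r∥s with dec (r ≤ g) | dec (s ≤ g) | dec (g ≤ r) | dec (g ≤ s)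
  ... | yes r≤g | _       | _       | _       = inj₁ r≤g
  ... | no _    | yes s≤g | _       | _       = inj₂ (inj₁ s≤g)
  ... | no _    | no _    | yes g≤r | yes g≤s = inj₂ (inj₂ (g≤r , g≤s))
  ... | no r≰g  | no s≰g  | yes g≤r | no g≰s  = ⊥-elim (proj₂ r∥s (threePoint (g≰s , s≰g) g≤r r≰g))
  ... | no r≰g  | no s≰g  | no g≰r  | yes g≤s = ⊥-elim (proj₁ r∥s (threePoint (g≰r , r≰g) g≤s s≰g))
  ... | no r≰g  | no s≰g  | no g≰r  | no g≰s  = ⊥-elim (noAntichain (g≰r , r≰g) (g≰s , s≰g) r∥s)

module DiamondImage (lem : (ℓ : Level) → ExcludedMiddle ℓ)
                    {a r} {X : Set a} {_≤_ : Rel X r} (F : IsDiamondFrame _≤_)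
                    (x₀ : X) (x₀≤ : ∀ x → x₀ ≤ x)
                    {b q} {Y : Set b} {_⊑_ : Rel Y q} (isPO : IsPartialOrder _≡_ _⊑_)
                    {π : X → Y} (isBM : IsBoundedMorphism _≤_ _⊑_ π)
                    (surjective : ∀ j → ∃ λ x → π x ≡ j) where
  open Classical lem
  open IsDiamondFrame F
  open ThreePointFrame lem isThreePointFrame
  open IsBoundedMorphism isBM
  open IsPartialOrder isPO using (antisym) renaming (refl to ⊑-refl; trans to ⊑-trans)

  reflect-incomparable : ∀ {x y} → Incomparable _⊑_ (π x) (π y) → Incomparable _≤_ x y
  reflect-incomparable (πx⋢πy , πy⋢πx) = (πx⋢πy ∘ forth) , (πy⋢πx ∘ forth)

  upperBound-lift : ∀ {x y u} → Incomparable _⊑_ (π x) (π y) → π x ⊑ π u → π y ⊑ π u → y ≤ u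
  upperBound-lift {x} {y} {u} πx∥πy πx⊑πu πy⊑πu with dec (y ≤ u) | dec (u ≤ y)
  ... | yes y≤u | _       = y≤u
  ... | no _    | yes u≤y = contradiction (⊑-trans πx⊑πu (forth u≤y)) (proj₁ πx∥πy)
  ... | no y≰u  | no u≰y  = contradiction (subst (π y ⊑_) (sym πx≡πu) πy⊑πu) (proj₂ πx∥πy)
    where
    πx≡πu : π x ≡ π u
    πx≡πu = antisym πx⊑πu (forth (partner-unique (y≰u , u≰y) (swap (reflect-incomparable πx∥πy))))

  image-D1 : D1 _⊑_
  image-D1 _ p q s _ _ _ _ p≢s _ p∥q p⊑s with surjective p | surjective q
  ... | p̃ , refl | q̃ , refl with back p⊑s
  ... | s̃ , p̃≤s̃ , refl =
    forth (threePoint (reflect-incomparable p∥q) p̃≤s̃ λ s̃≤p̃ → p≢s (antisym p⊑s (forth s̃≤p̃)))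

  image-D2 : D2 _⊑_
  image-D2 _ p q s _ _ _ (p∥q , p∥s , q∥s) with surjective p | surjective q | surjective s
  ... | p̃ , refl | q̃ , refl | s̃ , refl =
    noAntichain (reflect-incomparable p∥q) (reflect-incomparable p∥s) (reflect-incomparable q∥s)

  image-D3 : D3 _⊑_
  image-D3 _ y z _ _ with surjective y | surjective z
  ... | ỹ , refl | z̃ , refl with directed ỹ z̃
  ... | w , ỹ≤w , z̃≤w = π w , forth ỹ≤w , forth z̃≤w

  image-D4 : D4 _⊑_
  image-D4 _ x y z v _ _ _ x⊑z x⊑v y⊑z y⊑v _ _
    with dec (x ⊑ y) | dec (y ⊑ x) | dec (z ⊑ v) | dec (v ⊑ z)
  ... | yes x⊑y | _       | _       | _       = y , x⊑y , ⊑-refl , y⊑z , y⊑v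
  ... | no _    | yes y⊑x | _       | _       = x , ⊑-refl , y⊑x , x⊑z , x⊑v
  ... | no _    | no _    | yes z⊑v | _       = z , x⊑z , y⊑z , ⊑-refl , z⊑v
  ... | no _    | no _    | no _    | yes v⊑z = v , x⊑v , y⊑v , v⊑z , ⊑-refl
  ... | no x⋢y  | no y⋢x  | no z⋢v  | no v⋢z with surjective x | surjective y
  ... | x̃ , refl | ỹ , refl with back x⊑z | back x⊑v
  ... | z̃ , x̃≤z̃ , refl | ṽ , x̃≤ṽ , refl
    with interpolate (reflect-incomparable (x⋢y , y⋢x)) (reflect-incomparable (z⋢v , v⋢z)) x̃≤z̃ x̃≤ṽ
                     (upperBound-lift (x⋢y , y⋢x) x⊑z y⊑z) (upperBound-lift (x⋢y , y⋢x) x⊑v y⊑v)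
  ... | w , x̃≤w , ỹ≤w , w≤z̃ , w≤ṽ = π w , forth x̃≤w , forth ỹ≤w , forth w≤z̃ , forth w≤ṽ

  image-isDiamondSequence : IsDiamondSequence _⊑_
  image-isDiamondSequence = (image-D1 , image-D2 , image-D3 , image-D4) , lowerBound
    where
    lowerBound : ∀ x y → ∃ λ w → w ⊑ x × w ⊑ y
    lowerBound x y with surjective x | surjective y
    ... | x̃ , refl | ỹ , refl = π x₀ , forth (x₀≤ x̃) , forth (x₀≤ ỹ)

-- Finite quotients

∈-tabulate⇔ : ∀ {n} {f : Fin n → Bool} {k} → k ∈ tabulate f ⇔ f k ≡ true
∈-tabulate⇔ {f = f} {k} = mk⇔
  (λ k∈ → trans (sym (lookup∘tabulate f k)) ([]=⇒lookup k∈))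
  (λ fk → lookup⇒[]= k (tabulate f) (trans (lookup∘tabulate f k) fk))

∪⊆∩ : ∀ {n} {p q r s : Subset n} → p ⊆ r → p ⊆ s → q ⊆ r → q ⊆ s → p ∪ q ⊆ r ∩ s
∪⊆∩ {p = p} {q} p⊆r p⊆s q⊆r q⊆s x∈p∪q with x∈p∪q⁻ p q x∈p∪q
... | inj₁ x∈p = x∈p∩q⁺ (p⊆r x∈p , p⊆s x∈p)
... | inj₂ x∈q = x∈p∩q⁺ (q⊆r x∈q , q⊆s x∈q)

-- A code (t , s) stands for a point of type t whose partner has type s (s = t if it has none).
-- For points x < y every type in the code of x is contained in every type in that of y, which
-- is what _≤ᶜ_ records.
Code : ℕ → Set
Code n = Subset n × Subset n

_≟ᶜ_ : ∀ {n} → DecidableEquality (Code n)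
_≟ᶜ_ = ×-≡-dec (Vec-≡-dec Bool._≟_) (Vec-≡-dec Bool._≟_)

module _ {n : ℕ} where

  ⋃ᶜ ⋂ᶜ : Code n → Subset n
  ⋃ᶜ (t , s) = t ∪ s
  ⋂ᶜ (t , s) = t ∩ s

  infix 4 _≤ᶜ_
  _≤ᶜ_ : Rel (Code n) 0ℓ
  c ≤ᶜ d = c ≡ d ⊎ ⋃ᶜ c ⊆ ⋂ᶜ d

  ⋂ᶜ⊆⋃ᶜ : ∀ c → ⋂ᶜ c ⊆ ⋃ᶜ c
  ⋂ᶜ⊆⋃ᶜ (t , s) = ⊆-trans (p∩q⊆p t s) (p⊆p∪q s)

  ⋃⊆⋂⇒proj₁⊆ : ∀ {c d} → ⋃ᶜ c ⊆ ⋂ᶜ d → proj₁ c ⊆ proj₁ d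
  ⋃⊆⋂⇒proj₁⊆ {t , s} {t′ , s′} h = ⊆-trans (p⊆p∪q s) (⊆-trans h (p∩q⊆p t′ s′))

  ⋃⊆⋂⇒proj₂⊆ : ∀ {c d} → ⋃ᶜ c ⊆ ⋂ᶜ d → proj₂ c ⊆ proj₂ d
  ⋃⊆⋂⇒proj₂⊆ {t , s} {t′ , s′} h = ⊆-trans (q⊆p∪q t s) (⊆-trans h (p∩q⊆q t′ s′))

  ≤ᶜ⇒proj₁⊆ : ∀ {c d} → c ≤ᶜ d → proj₁ c ⊆ proj₁ d
  ≤ᶜ⇒proj₁⊆ (inj₁ refl) = ⊆-refl
  ≤ᶜ⇒proj₁⊆ (inj₂ h)    = ⋃⊆⋂⇒proj₁⊆ h

  ≤ᶜ-trans : Transitive _≤ᶜ_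
  ≤ᶜ-trans (inj₁ refl) d≤e          = d≤e
  ≤ᶜ-trans (inj₂ h)    (inj₁ refl)  = inj₂ h
  ≤ᶜ-trans {j = d} (inj₂ h) (inj₂ k) = inj₂ (⊆-trans h (⊆-trans (⋂ᶜ⊆⋃ᶜ d) k))

  ≤ᶜ-antisym : ∀ {c d} → c ≤ᶜ d → d ≤ᶜ c → c ≡ d
  ≤ᶜ-antisym (inj₁ c≡d) _           = c≡d
  ≤ᶜ-antisym (inj₂ _)   (inj₁ d≡c)  = sym d≡c
  ≤ᶜ-antisym (inj₂ h)   (inj₂ k)    =
    cong₂ _,_ (⊆-antisym (⋃⊆⋂⇒proj₁⊆ h) (⋃⊆⋂⇒proj₁⊆ k)) (⊆-antisym (⋃⊆⋂⇒proj₂⊆ h) (⋃⊆⋂⇒proj₂⊆ k))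

allSubsets : ∀ n → List (Subset n)
allSubsets zero    = [] ∷ []
allSubsets (suc n) = map (inside ∷_) (allSubsets n) ++ map (outside ∷_) (allSubsets n)

∈-allSubsets : ∀ {n} (p : Subset n) → p ∈ˡ allSubsets n
∈-allSubsets []                    = here refl
∈-allSubsets (inside ∷ p)          = ∈-++⁺ˡ (∈-map⁺ (inside ∷_) (∈-allSubsets p))
∈-allSubsets {suc n} (outside ∷ p) =
  ∈-++⁺ʳ (map (inside ∷_) (allSubsets n)) (∈-map⁺ (outside ∷_) (∈-allSubsets p))

allCodes : ∀ n → List (Code n)
allCodes n = cartesianProduct (allSubsets n) (allSubsets n)

∈-allCodes : ∀ {n} (c : Code n) → c ∈ˡ allCodes n
∈-allCodes (t , s) = ∈-cartesianProduct⁺ (∈-allSubsets t) (∈-allSubsets s)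

lookup-injective : ∀ {a} {A : Set a} {xs : List A} → Unique xs →
                   ∀ i j → lookup xs i ≡ lookup xs j → i ≡ j
lookup-injective (_   ∷ _) zero    zero    _ = refl
lookup-injective (x∉ ∷ _) zero    (suc j) e = contradiction e (All.lookup x∉ (∈-lookup j))
lookup-injective (x∉ ∷ _) (suc i) zero    e = contradiction (sym e) (All.lookup x∉ (∈-lookup i))
lookup-injective (_   ∷ u) (suc i) (suc j) e = cong suc (lookup-injective u i j e)


module FiniteQuotient (lem : (ℓ : Level) → ExcludedMiddle ℓ)
                      {a r} {X : Set a} {_≤_ : Rel X r} (F : IsDiamondFrame _≤_)
                      (x₀ : X) (x₀≤ : ∀ x → x₀ ≤ x)
                      (v : ℕ → X → Set (L X _≤_)) (v-up : ∀ i → IsUpset X _≤_ (v i)) (n : ℕ) where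
  open Classical lem
  open IsDiamondFrame F
  open ThreePointFrame lem isThreePointFrame

  type : X → Subset n
  type x = tabulate λ k → isYes (dec (v (toℕ k) x))

  ∈-type⇔ : ∀ {k x} → k ∈ type x ⇔ v (toℕ k) x
  ∈-type⇔ = mk⇔ (λ k∈ → toWitness (from T-≡ (to ∈-tabulate⇔ k∈)))
                (λ vkx → from ∈-tabulate⇔ (to T-≡ (fromWitness vkx)))

  type-mono : ∀ {x y} → x ≤ y → type x ⊆ type y
  type-mono x≤y k∈ = from ∈-type⇔ (v-up _ x≤y (to ∈-type⇔ k∈))

  type-cong : ∀ {x y} → x ≤ y → y ≤ x → type x ≡ type y
  type-cong x≤y y≤x = ⊆-antisym (type-mono x≤y) (type-mono y≤x)

  HasPartner : X → Set (a ⊔ r)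
  HasPartner x = ∃ (Incomparable _≤_ x)

  partnerType : X → Subset n
  partnerType x with dec (HasPartner x)
  ... | yes (z , _) = type z
  ... | no _        = type x

  partnerType-partner : ∀ {x z} → Incomparable _≤_ x z → partnerType x ≡ type z
  partnerType-partner {x} x∥z with dec (HasPartner x)
  ... | yes (_ , x∥z′) = type-cong (partner-unique x∥z′ x∥z) (partner-unique x∥z x∥z′)
  ... | no alone       = contradiction (_ , x∥z) alone

  partnerType⊆type : ∀ {x y} → x ≤ y → ¬ y ≤ x → partnerType x ⊆ type y
  partnerType⊆type {x} x≤y y≰x with dec (HasPartner x)
  ... | yes (_ , x∥z) = type-mono (threePoint x∥z x≤y y≰x)
  ... | no _          = type-mono x≤y

  type⊆partnerType : ∀ {x y} → x ≤ y → ¬ y ≤ x → type x ⊆ partnerType y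
  type⊆partnerType {y = y} x≤y y≰x with dec (HasPartner y)
  ... | yes (_ , y∥w) = type-mono (partner-above x≤y y≰x y∥w)
  ... | no _          = type-mono x≤y

  partnerType-mono : ∀ {x y} → x ≤ y → ¬ y ≤ x → partnerType x ⊆ partnerType y
  partnerType-mono {y = y} x≤y y≰x with dec (HasPartner y)
  ... | yes (_ , y∥w) =
    partnerType⊆type (partner-above x≤y y≰x y∥w) λ w≤x → proj₂ y∥w (≤-trans w≤x x≤y)
  ... | no _          = partnerType⊆type x≤y y≰x

  partnerType-cong : ∀ {x y} → x ≤ y → y ≤ x → partnerType x ≡ partnerType y
  partnerType-cong {x} {y} x≤y y≤x with dec (HasPartner x) | dec (HasPartner y)
  ... | yes (_ , x∥z) | yes (_ , y∥z′) =
    type-cong (partner-unique y∥z y∥z′) (partner-unique y∥z′ y∥z)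
    where y∥z = incomparable-cong x≤y y≤x x∥z
  ... | yes (z , x∥z) | no alone       = contradiction (z , incomparable-cong x≤y y≤x x∥z) alone
  ... | no alone      | yes (z , y∥z)  = contradiction (z , incomparable-cong y≤x x≤y y∥z) alone
  ... | no _          | no _           = type-cong x≤y y≤x

  code : X → Code n
  code x = type x , partnerType x

  code-cong : ∀ {x y} → x ≤ y → y ≤ x → code x ≡ code y
  code-cong x≤y y≤x = cong₂ _,_ (type-cong x≤y y≤x) (partnerType-cong x≤y y≤x)

  code-mono : ∀ {x y} → x ≤ y → code x ≤ᶜ code y
  code-mono {x} {y} x≤y with dec (y ≤ x)
  ... | yes y≤x = inj₁ (code-cong x≤y y≤x)
  ... | no y≰x  = inj₂ (∪⊆∩ (type-mono x≤y) (type⊆partnerType x≤y y≰x)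
                           (partnerType⊆type x≤y y≰x) (partnerType-mono x≤y y≰x))

  code-partners : ∀ {x y} → Incomparable _≤_ x y → ⋃ᶜ (code x) ⊆ ⋂ᶜ (code y) → code x ≡ code y
  code-partners {x} {y} x∥y h = cong₂ _,_ tx≡ty
    (trans (partnerType-partner x∥y) (trans (sym tx≡ty) (sym (partnerType-partner (swap x∥y)))))
    where
    tx≡ty : type x ≡ type y
    tx≡ty = ⊆-antisym (⋃⊆⋂⇒proj₁⊆ h)
      (subst₂ _⊆_ (partnerType-partner x∥y) (partnerType-partner (swap x∥y)) (⋃⊆⋂⇒proj₂⊆ h))

  code-back : ∀ {x y} → code x ≤ᶜ code y → ∃ λ z → x ≤ z × code z ≡ code y
  code-back {x} {y} (inj₁ cx≡cy) = x , ≤-refl , cx≡cy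
  code-back {x} {y} (inj₂ h) with dec (x ≤ y) | dec (y ≤ x)
  ... | yes x≤y | _       = y , x≤y , refl
  ... | no _    | yes y≤x = x , ≤-refl , ≤ᶜ-antisym (inj₂ h) (code-mono y≤x)
  ... | no x≰y  | no y≰x  = x , ≤-refl , code-partners (x≰y , y≰x) h

  Realized : Code n → Set a
  Realized c = ∃ λ x → code x ≡ c

  candidates : List (Code n)
  candidates = filter (dec ∘ Realized) (allCodes n)

  realizedCodes : List (Code n)
  realizedCodes = deduplicate _≟ᶜ_ candidates

  size : ℕ
  size = length realizedCodes

  codeAt : Fin size → Code n
  codeAt = lookup realizedCodes

  codeAt-injective : ∀ {i j} → codeAt i ≡ codeAt j → i ≡ j
  codeAt-injective = lookup-injective (deduplicate-! _≟ᶜ_ candidates) _ _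

  codeAt-realized : ∀ j → Realized (codeAt j)
  codeAt-realized j =
    proj₂ (∈-filter⁻ (dec ∘ Realized) {xs = allCodes n}
                     (∈-deduplicate⁻ _≟ᶜ_ candidates (∈-lookup j)))

  code-listed : ∀ x → code x ∈ˡ realizedCodes
  code-listed x =
    ∈-deduplicate⁺ _≟ᶜ_ {xs = candidates} (∈-filter⁺ (dec ∘ Realized) (∈-allCodes (code x)) (x , refl))

  π : X → Fin size
  π x = index (code-listed x)

  codeAt-π : ∀ x → codeAt (π x) ≡ code x
  codeAt-π x = sym (lookup-index (code-listed x))

  infix 4 _⊑_
  _⊑_ : Rel (Fin size) 0ℓ
  i ⊑ j = codeAt i ≤ᶜ codeAt j

  ⊑-isPartialOrder : IsPartialOrder _≡_ _⊑_
  ⊑-isPartialOrder = record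
    { isPreorder = record
      { isEquivalence = ≡.isEquivalence
      ; reflexive     = λ { refl → inj₁ refl }
      ; trans         = ≤ᶜ-trans }
    ; antisym = λ i⊑j j⊑i → codeAt-injective (≤ᶜ-antisym i⊑j j⊑i) }

  π-surjective : ∀ j → ∃ λ x → π x ≡ j
  π-surjective j with codeAt-realized j
  ... | x , codeX≡ = x , codeAt-injective (trans (codeAt-π x) codeX≡)

  π-isBoundedMorphism : IsBoundedMorphism _≤_ _⊑_ π
  π-isBoundedMorphism = record { forth = forth ; back = back }
    where
    forth : ∀ {x y} → x ≤ y → π x ⊑ π y
    forth {x} {y} x≤y = subst₂ _≤ᶜ_ (sym (codeAt-π x)) (sym (codeAt-π y)) (code-mono x≤y)
    back : ∀ {x j} → π x ⊑ j → ∃ λ y → x ≤ y × π y ≡ j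
    back {x} {j} πx⊑j with codeAt-realized j
    ... | y , codeY≡ with code-back (subst₂ _≤ᶜ_ (codeAt-π x) (sym codeY≡) πx⊑j)
    ... | z , x≤z , codeZ≡ = z , x≤z , codeAt-injective (trans (codeAt-π z) (trans codeZ≡ codeY≡))

  quotient : FiniteDiamondSequence
  quotient = record
    { size      = size
    ; _≼_       = _⊑_
    ; isPO      = ⊑-isPartialOrder
    ; isDiamond = DiamondImage.image-isDiamondSequence lem F x₀ x₀≤
                    ⊑-isPartialOrder π-isBoundedMorphism π-surjective }

  valuation : ℕ → Fin size → Set
  valuation i j = Σ (i < n) λ i<n → fromℕ< i<n ∈ proj₁ (codeAt j)

  valuation-up : ∀ i → IsUpset (Fin size) _⊑_ (valuation i)
  valuation-up i i⊑j (i<n , i∈) = i<n , ≤ᶜ⇒proj₁⊆ i⊑j i∈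

  valuation-agrees : ∀ {i} → i < n → ∀ x → v i x ⇔ valuation i (π x)
  valuation-agrees {i} i<n x = mk⇔
    (λ vix → i<n , subst (λ c → fromℕ< i<n ∈ proj₁ c) (sym (codeAt-π x))
                         (from ∈-type⇔ (subst (λ k → v k x) (sym (toℕ-fromℕ< i<n)) vix)))
    (λ (i<n′ , i∈) → subst (λ k → v k x) (toℕ-fromℕ< i<n′)
                         (to ∈-type⇔ (subst (λ c → fromℕ< i<n′ ∈ proj₁ c) (codeAt-π x) i∈)))

module _ (lem : (ℓ : Level) → ExcludedMiddle ℓ) {a r} {X : Set a} {_≤_ : Rel X r}
         (≤-refl : Reflexive _≤_) (≤-trans : Transitive _≤_) where

  diamondCones⇒UpInDHA : (∀ x → IsDiamondFrame (_≤↑_ _≤_ x)) → UpInDHA X _≤_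
  diamondCones⇒UpInDHA cone-isDiamondFrame (s , t) valid v v-up x = to s⇔t , from s⇔t
    where
    n : ℕ
    n = varBound s ℕ.⊔ varBound t
    x̂ : Above _≤_ x
    x̂ = x , ≤-refl
    v̂ : ℕ → Above _≤_ x → Set (L X _≤_)
    v̂ i = v i ∘ proj₁
    open FiniteQuotient lem (cone-isDiamondFrame x) x̂ proj₂ v̂ (λ i → v-up i) n
    transfer : ∀ u → VarsBelow n u → evalUp X _≤_ v u x ⇔ evalUp (Fin size) _⊑_ valuation u (π x̂)
    transfer u u<n =
      boundedMorphism-preserves _ _ π-isBoundedMorphism v̂ valuation valuation-agrees u u<n x̂ ⇔-∘
      ⇔-sym (boundedMorphism-preserves _ _ (inclusion-isBoundedMorphism _≤_ x ≤-trans)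
                                       v̂ v (λ _ _ → ⇔-id _) u u<n x̂)
    s⇔t : evalUp X _≤_ v s x ⇔ evalUp X _≤_ v t x
    s⇔t = ⇔-sym (transfer t (varsBelow t (m≤n⊔m (varBound s) (varBound t)))) ⇔-∘
          (uncurry mk⇔ (valid quotient valuation valuation-up (π x̂)) ⇔-∘
           transfer s (varsBelow s (m≤m⊔n (varBound s) (varBound t))))

-- Four laws of DHA

¬ᵗ_ : Term → Term
¬ᵗ φ = φ imp bot

p₀ p₁ p₂ p₃ : Term
p₀ = var 0
p₁ = var 1
p₂ = var 2
p₃ = var 3

boundedWidth₂ threePointLaw weakExcludedMiddle diamondLaw : Term
boundedWidth₂      = (p₀ imp (p₁ or p₂)) or ((p₁ imp (p₀ or p₂)) or (p₂ imp (p₀ or p₁)))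
threePointLaw      = (p₂ imp (p₁ or (p₀ or (p₀ imp p₁)))) or (p₁ imp p₂)
weakExcludedMiddle = (¬ᵗ p₀) or (¬ᵗ ¬ᵗ p₀)
diamondLaw         = ((p₀ and p₁) imp (p₂ or p₃)) imp
                     ((p₀ imp p₁) or ((p₁ imp p₀) or
                      ((((p₀ and p₁) and p₂) imp p₃) or (((p₀ and p₁) and p₃) imp p₂))))

module LawsOnFrames (lem : (ℓ : Level) → ExcludedMiddle ℓ)
                    {a r} {X : Set a} {_≤_ : Rel X r} (≤-trans : Transitive _≤_)
                    (v : ℕ → X → Set (L X _≤_)) (v-up : ∀ i → IsUpset X _≤_ (v i)) where
  open Classical lem

  ⟦_⟧ : Term → X → Set (L X _≤_)
  ⟦_⟧ = evalUp X _≤_ v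

  separated⇒≰ : ∀ {i p q} → v i p → ¬ v i q → ¬ p ≤ q
  separated⇒≰ {i} vip ¬viq p≤q = ¬viq (v-up i p≤q vip)

  separated⇒≢ : ∀ {i p q} → v i p → ¬ v i q → ¬ p ≡ q
  separated⇒≢ {i} vip ¬viq refl = ¬viq vip

  boundedWidth₂-holds : D2 _≤_ → ∀ x → ⟦ boundedWidth₂ ⟧ x
  boundedWidth₂-holds d2 x = dne λ none →
    let p , x≤p , v₀p , ¬v₁₂p = ¬∀→→⇒∃××¬ (none ∘ inj₁)
        q , x≤q , v₁q , ¬v₀₂q = ¬∀→→⇒∃××¬ (none ∘ inj₂ ∘ inj₁)
        s , x≤s , v₂s , ¬v₀₁s = ¬∀→→⇒∃××¬ (none ∘ inj₂ ∘ inj₂)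
    in d2 x p q s x≤p x≤q x≤s
          ( (separated⇒≰ v₀p (¬v₀₂q ∘ inj₁) , separated⇒≰ v₁q (¬v₁₂p ∘ inj₁))
          , (separated⇒≰ v₀p (¬v₀₁s ∘ inj₁) , separated⇒≰ v₂s (¬v₁₂p ∘ inj₂))
          , (separated⇒≰ v₁q (¬v₀₁s ∘ inj₂) , separated⇒≰ v₂s (¬v₀₂q ∘ inj₂)) )

  threePointLaw-holds : D1 _≤_ → ∀ x → ⟦ threePointLaw ⟧ x
  threePointLaw-holds d1 x = dne λ none →
    let z , x≤z , v₁z , ¬v₂z  = ¬∀→→⇒∃××¬ (none ∘ inj₂)
        y , x≤y , v₂y , ¬rest = ¬∀→→⇒∃××¬ (none ∘ inj₁)
        s , y≤s , v₀s , ¬v₁s  = ¬∀→→⇒∃××¬ (¬rest ∘ inj₂ ∘ inj₂)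
        z≤s = d1 x y z s x≤y x≤z (≤-trans x≤y y≤s)
                 (separated⇒≢ v₂y ¬v₂z) (separated⇒≢ v₀s (¬rest ∘ inj₂ ∘ inj₁) ∘ sym)
                 (separated⇒≢ v₁z ¬v₁s)
                 (separated⇒≰ v₂y ¬v₂z , separated⇒≰ v₁z (¬rest ∘ inj₁)) y≤s
    in ¬v₁s (v-up 1 z≤s v₁z)

  weakExcludedMiddle-holds : D3 _≤_ → ∀ x → ⟦ weakExcludedMiddle ⟧ x
  weakExcludedMiddle-holds d3 x = dne λ none →
    let y , x≤y , v₀y , _ = ¬∀→→⇒∃××¬ (none ∘ inj₁)
    in none (inj₂ λ z x≤z ¬v₀ →
         let w , y≤w , z≤w = d3 x y z x≤y x≤z in ¬v₀ w z≤w (v-up 0 y≤w v₀y))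

  exclusive≤common : D1 _≤_ → D2 _≤_ → ∀ {i j x y z u} → x ≤ y → x ≤ z → x ≤ u →
                     v i y → ¬ v j y → v j z → ¬ v i z → v i u → v j u → y ≤ u
  exclusive≤common d1 d2 {i} {j} {x} {y} {z} {u} x≤y x≤z x≤u viy ¬vjy vjz ¬viz viu vju
    with dec (y ≤ u) | dec (z ≤ u)
  ... | yes y≤u | _       = y≤u
  ... | no _    | yes z≤u =
    d1 x z y u x≤z x≤y x≤u
       (separated⇒≢ viy ¬viz ∘ sym) (separated⇒≢ viu ¬viz ∘ sym) (separated⇒≢ vju ¬vjy ∘ sym)
       (separated⇒≰ vjz ¬vjy , separated⇒≰ viy ¬viz) z≤u
  ... | no y≰u  | no z≰u  = ⊥-elim (d2 x y z u x≤y x≤z x≤u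
    ( (separated⇒≰ viy ¬viz , separated⇒≰ vjz ¬vjy)
    , (y≰u , separated⇒≰ vju ¬vjy)
    , (z≰u , separated⇒≰ viu ¬viz) ))

  diamondLaw-holds : IsDiamondSystem _≤_ → ∀ x → ⟦ diamondLaw ⟧ x
  diamondLaw-holds (d1 , d2 , d3 , d4) _ x _ premise = dne λ none →
    let y  , x≤y  , v₀y    , ¬v₁y  = ¬∀→→⇒∃××¬ (none ∘ inj₁)
        z  , x≤z  , v₁z    , ¬v₀z  = ¬∀→→⇒∃××¬ (none ∘ inj₂ ∘ inj₁)
        u  , x≤u  , v₀₁₂u  , ¬v₃u  = ¬∀→→⇒∃××¬ (none ∘ inj₂ ∘ inj₂ ∘ inj₁)
        u′ , x≤u′ , v₀₁₃u′ , ¬v₂u′ = ¬∀→→⇒∃××¬ (none ∘ inj₂ ∘ inj₂ ∘ inj₂)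
        v₀u  = proj₁ (proj₁ v₀₁₂u)
        v₁u  = proj₂ (proj₁ v₀₁₂u)
        v₀u′ = proj₁ (proj₁ v₀₁₃u′)
        v₁u′ = proj₂ (proj₁ v₀₁₃u′)
        t , u≤t , u′≤t = d3 x u u′ x≤u x≤u′
        w , y≤w , z≤w , w≤u , w≤u′ =
          d4 x y z u u′ t x≤y x≤z
             (exclusive≤common d1 d2 x≤y x≤z x≤u  v₀y ¬v₁y v₁z ¬v₀z v₀u  v₁u)
             (exclusive≤common d1 d2 x≤y x≤z x≤u′ v₀y ¬v₁y v₁z ¬v₀z v₀u′ v₁u′)
             (exclusive≤common d1 d2 x≤z x≤y x≤u  v₁z ¬v₀z v₀y ¬v₁y v₁u  v₀u)
             (exclusive≤common d1 d2 x≤z x≤y x≤u′ v₁z ¬v₀z v₀y ¬v₁y v₁u′ v₀u′)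
             u≤t u′≤t
    in case premise w (≤-trans x≤y y≤w) (v-up 0 y≤w v₀y , v-up 1 z≤w v₁z) of λ where
         (inj₁ v₂w) → ¬v₂u′ (v-up 2 w≤u′ v₂w)
         (inj₂ v₃w) → ¬v₃u  (v-up 3 w≤u v₃w)

module DHALaws (lem : (ℓ : Level) → ExcludedMiddle ℓ) where
  open LawsOnFrames lem

  holdsOnDiamondSystems⇒valid :
    ∀ φ → (∀ {a r} {X : Set a} {_≤_ : Rel X r} → Transitive _≤_ → IsDiamondSystem _≤_ →
           ∀ v → (∀ i → IsUpset X _≤_ (v i)) → ∀ x → evalUp X _≤_ v φ x) →
    ValidInDHA (φ , top)
  holdsOnDiamondSystems⇒valid φ holds Y v v-up x =
    (λ _ → ttₚ) , λ _ → holds (IsPartialOrder.trans isPO) (proj₁ isDiamond) v v-up x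
    where open FiniteDiamondSequence Y

  boundedWidth₂-valid : ValidInDHA (boundedWidth₂ , top)
  boundedWidth₂-valid = holdsOnDiamondSystems⇒valid boundedWidth₂
    λ ≤-trans (_ , d2 , _) v v-up → boundedWidth₂-holds ≤-trans v v-up d2

  threePointLaw-valid : ValidInDHA (threePointLaw , top)
  threePointLaw-valid = holdsOnDiamondSystems⇒valid threePointLaw
    λ ≤-trans (d1 , _) v v-up → threePointLaw-holds ≤-trans v v-up d1

  weakExcludedMiddle-valid : ValidInDHA (weakExcludedMiddle , top)
  weakExcludedMiddle-valid = holdsOnDiamondSystems⇒valid weakExcludedMiddle
    λ ≤-trans (_ , _ , d3 , _) v v-up → weakExcludedMiddle-holds ≤-trans v v-up d3

  diamondLaw-valid : ValidInDHA (diamondLaw , top)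
  diamondLaw-valid = holdsOnDiamondSystems⇒valid diamondLaw
    λ ≤-trans diamond v v-up → diamondLaw-holds ≤-trans v v-up diamond

-- Prime filters

module _ {c ℓ₁ ℓ₂} (A : HeytingAlgebra c ℓ₁ ℓ₂) where
  open HeytingAlgebra A renaming (refl to ≤-refl; trans to ≤-trans)
  open HeytingAlgebraProperties A using (∧-distribˡ-∨-≤)
  open MeetSemilatticeProperties meetSemilattice using (∧-monotonic; ∧-assoc)

  record IsFilter {p} (Φ : Carrier → Set p) : Set (c ⊔ ℓ₂ ⊔ p) where
    field
      upClosed : ∀ {x y} → x ≤ y → Φ x → Φ y
      hasTop   : Φ ⊤
      meetCl   : ∀ {x y} → Φ x → Φ y → Φ (x ∧ y)

  primeFilter-isFilter : ∀ {p} {Φ : Carrier → Set p} → IsPrimeFilter A Φ → IsFilter Φ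
  primeFilter-isFilter isPF = record { upClosed = upClosed ; hasTop = hasTop ; meetCl = meetCl }
    where open IsPrimeFilter isPF

  module FilterQuotient (lem : (ℓ : Level) → ExcludedMiddle ℓ)
                        {p} {Φ : Carrier → Set p} (isFilter : IsFilter Φ) where
    open Classical lem
    private module Filter = IsFilter isFilter

    infix 4 _≤Φ_
    _≤Φ_ : Rel Carrier (c ⊔ ℓ₂ ⊔ p)
    x ≤Φ y = ∃ λ f → Φ f × f ∧ x ≤ y

    ≤⇒≤Φ : ∀ {x y} → x ≤ y → x ≤Φ y
    ≤⇒≤Φ x≤y = ⊤ , Filter.hasTop , ≤-trans (x∧y≤y _ _) x≤y

    ⊤≤Φ⇒∈ : ∀ {x} → ⊤ ≤Φ x → Φ x
    ⊤≤Φ⇒∈ (f , Φf , f∧⊤≤x) = Filter.upClosed (≤-trans (∧-greatest ≤-refl (maximum f)) f∧⊤≤x) Φf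

    strengthen : ∀ {f g x y} → g ≤ f → f ∧ x ≤ y → g ∧ x ≤ y
    strengthen g≤f fx≤y = ≤-trans (∧-monotonic g≤f ≤-refl) fx≤y

    ≤Φ-trans : Transitive _≤Φ_
    ≤Φ-trans (f , Φf , fx≤y) (g , Φg , gy≤z) = g ∧ f , Filter.meetCl Φg Φf ,
      ≤-trans (reflexive (∧-assoc g f _)) (≤-trans (∧-monotonic ≤-refl fx≤y) gy≤z)

    ≤Φ-∧-greatest : ∀ {x y z} → x ≤Φ y → x ≤Φ z → x ≤Φ y ∧ z
    ≤Φ-∧-greatest (f , Φf , fx≤y) (g , Φg , gx≤z) = f ∧ g , Filter.meetCl Φf Φg ,
      ∧-greatest (strengthen (x∧y≤x f g) fx≤y) (strengthen (x∧y≤y f g) gx≤z)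

    ≤Φ-∨-least : ∀ {x y z} → x ≤Φ z → y ≤Φ z → x ∨ y ≤Φ z
    ≤Φ-∨-least (f , Φf , fx≤z) (g , Φg , gy≤z) = f ∧ g , Filter.meetCl Φf Φg ,
      ≤-trans (∧-distribˡ-∨-≤ (f ∧ g) _ _)
              (∨-least (strengthen (x∧y≤x f g) fx≤z) (strengthen (x∧y≤y f g) gy≤z))

    ≤Φ-transpose-⇨ : ∀ {w x y} → w ∧ x ≤Φ y → w ≤Φ x ⇨ y
    ≤Φ-transpose-⇨ {w} {x} (f , Φf , fwx≤y) =
      f , Φf , transpose-⇨ (≤-trans (reflexive (∧-assoc f w x)) fwx≤y)

    ≤Φ-transpose-∧ : ∀ {w x y} → w ≤Φ x ⇨ y → w ∧ x ≤Φ y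
    ≤Φ-transpose-∧ {w} {x} (f , Φf , fw≤x⇨y) =
      f , Φf , ≤-trans (reflexive (Eq.sym (∧-assoc f w x))) (transpose-∧ fw≤x⇨y)

    -- A/Φ has to live at the levels of A for the prime filter theorem to apply to it, so its
    -- order is x ≤Φ y squashed by excluded middle.
    _≤/_ : Rel Carrier ℓ₂
    x ≤/ y = Lift ℓ₂ (True (dec (x ≤Φ y)))

    _≈/_ : Rel Carrier ℓ₁
    x ≈/ y = Lift ℓ₁ (True (dec (x ≤Φ y × y ≤Φ x)))

    squash : ∀ {x y} → x ≤Φ y → x ≤/ y
    squash = lift ∘ fromWitness

    unsquash : ∀ {x y} → x ≤/ y → x ≤Φ y
    unsquash = toWitness ∘ lower

    squash≈ : ∀ {x y} → x ≤Φ y → y ≤Φ x → x ≈/ y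
    squash≈ x≤y y≤x = lift (fromWitness (x≤y , y≤x))

    unsquash≈ : ∀ {x y} → x ≈/ y → x ≤Φ y × y ≤Φ x
    unsquash≈ = toWitness ∘ lower

    A/Φ : HeytingAlgebra c ℓ₁ ℓ₂
    A/Φ = record
      { Carrier = Carrier ; _≈_ = _≈/_ ; _≤_ = _≤/_
      ; _∨_ = _∨_ ; _∧_ = _∧_ ; _⇨_ = _⇨_ ; ⊤ = ⊤ ; ⊥ = ⊥
      ; isHeytingAlgebra = record
        { isBoundedLattice = record
          { isLattice = record
            { isPartialOrder = record
              { isPreorder = record
                { isEquivalence = record
                  { refl  = squash≈ (≤⇒≤Φ ≤-refl) (≤⇒≤Φ ≤-refl)
                  ; sym   = λ x≈y → let x≤y , y≤x = unsquash≈ x≈y in squash≈ y≤x x≤y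
                  ; trans = λ x≈y y≈z → let x≤y , y≤x = unsquash≈ x≈y ; y≤z , z≤y = unsquash≈ y≈z
                                        in squash≈ (≤Φ-trans x≤y y≤z) (≤Φ-trans z≤y y≤x) }
                ; reflexive = squash ∘ proj₁ ∘ unsquash≈
                ; trans     = λ x≤y y≤z → squash (≤Φ-trans (unsquash x≤y) (unsquash y≤z)) }
              ; antisym = λ x≤y y≤x → squash≈ (unsquash x≤y) (unsquash y≤x) }
            ; supremum = λ x y → squash (≤⇒≤Φ (x≤x∨y x y)) , squash (≤⇒≤Φ (y≤x∨y x y)) ,
                           λ _ x≤z y≤z → squash (≤Φ-∨-least (unsquash x≤z) (unsquash y≤z))
            ; infimum  = λ x y → squash (≤⇒≤Φ (x∧y≤x x y)) , squash (≤⇒≤Φ (x∧y≤y x y)) ,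
                           λ _ z≤x z≤y → squash (≤Φ-∧-greatest (unsquash z≤x) (unsquash z≤y)) }
          ; maximum = squash ∘ ≤⇒≤Φ ∘ maximum
          ; minimum = squash ∘ ≤⇒≤Φ ∘ minimum }
        ; exponential = λ _ _ _ →
            squash ∘ ≤Φ-transpose-⇨ ∘ unsquash , squash ∘ ≤Φ-transpose-∧ ∘ unsquash } }

    primeFilter-extension : PrimeFilterTheorem c ℓ₁ ℓ₂ → ∀ {a b} → ¬ a ≤Φ b →
                            Σ (PrimeFilter A) λ (G , _) → (∀ x → Φ x → G x) × G a × ¬ G b
    primeFilter-extension pft {a} {b} a≰b with pft A/Φ a b (a≰b ∘ unsquash)
    ... | (G , isPF) , Ga , ¬Gb = (G , isPF′) , Φ⊆G , Ga , ¬Gb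
      where
      open IsPrimeFilter isPF
      isPF′ : IsPrimeFilter A G
      isPF′ = record { upClosed = upClosed ∘ squash ∘ ≤⇒≤Φ ; hasTop = hasTop ; meetCl = meetCl
                     ; proper = proper ; prime = prime }
      Φ⊆G : ∀ x → Φ x → G x
      Φ⊆G x Φx = upClosed (squash (x , Φx , x∧y≤x x ⊤)) hasTop

module PrimeFilterFrame (lem : (ℓ : Level) → ExcludedMiddle ℓ)
                        {c ℓ₁ ℓ₂} (pft : PrimeFilterTheorem c ℓ₁ ℓ₂) (A : HeytingAlgebra c ℓ₁ ℓ₂) where
  open HeytingAlgebra A renaming (refl to ≤-refl; trans to ≤-trans)
  open MeetSemilatticeProperties meetSemilattice using (∧-monotonic)
  open Classical lem

  XA : Set (Level.suc (PLevel A))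
  XA = PrimeFilter A

  infix 4 _⊆ₚ_ _∋_
  _⊆ₚ_ : Rel XA (PLevel A)
  _⊆ₚ_ = _⊆PF_ A

  _∋_ : XA → Carrier → Set (PLevel A)
  F ∋ x = proj₁ F x

  module PF (F : XA) = IsPrimeFilter (proj₂ F)

  ⊆ₚ-refl : Reflexive _⊆ₚ_
  ⊆ₚ-refl _ F∋x = F∋x

  ⊆ₚ-trans : Transitive _⊆ₚ_
  ⊆ₚ-trans F⊆G G⊆H x F∋x = G⊆H x (F⊆G x F∋x)

  admissible : (ℕ → Carrier) → ℕ → XA → Set (L XA _⊆ₚ_)
  admissible ρ i F = Lift _ (F ∋ ρ i)

  ∋-∧⇔ : ∀ F {x y} → F ∋ x ∧ y ⇔ (F ∋ x × F ∋ y)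
  ∋-∧⇔ F = mk⇔ (λ F∋x∧y → PF.upClosed F (x∧y≤x _ _) F∋x∧y , PF.upClosed F (x∧y≤y _ _) F∋x∧y)
               (uncurry (PF.meetCl F))

  ∋-∨⇔ : ∀ F {x y} → F ∋ x ∨ y ⇔ (F ∋ x ⊎ F ∋ y)
  ∋-∨⇔ F = mk⇔ (PF.prime F) [ PF.upClosed F (x≤x∨y _ _) , PF.upClosed F (y≤x∨y _ _) ]′

  ∋-⇨⇔ : ∀ F {x y} → F ∋ x ⇨ y ⇔ (∀ G → F ⊆ₚ G → G ∋ x → G ∋ y)
  ∋-⇨⇔ F {x} {y} = mk⇔
    (λ F∋x⇨y G F⊆G G∋x → PF.upClosed G (transpose-∧ ≤-refl) (PF.meetCl G (F⊆G _ F∋x⇨y) G∋x))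
    (λ x⇒y → dne λ F∌x⇨y →
       let G , F⊆G , G∋x , G∌y = primeFilter-extension pft λ (f , F∋f , f∧x≤y) →
                                   F∌x⇨y (PF.upClosed F (transpose-⇨ f∧x≤y) F∋f)
       in G∌y (x⇒y G F⊆G G∋x))
    where open FilterQuotient A lem (primeFilter-isFilter A (proj₂ F))

  truth : ∀ ρ t F → F ∋ evalHA A ρ t ⇔ evalUp XA _⊆ₚ_ (admissible ρ) t F
  truth ρ (var i)   F = mk⇔ lift lower
  truth ρ top       F = mk⇔ (λ _ → ttₚ) (λ _ → PF.hasTop F)
  truth ρ bot       F = mk⇔ (⊥-elim ∘ PF.proper F) λ ()
  truth ρ (s and t) F = (truth ρ s F ×-⇔ truth ρ t F) ⇔-∘ ∋-∧⇔ F
  truth ρ (s or t)  F = (truth ρ s F ⊎-⇔ truth ρ t F) ⇔-∘ ∋-∨⇔ F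
  truth ρ (s imp t) F = mk⇔
    (λ s⇒t G F⊆G ⟦s⟧ → to (truth ρ t G) (s⇒t G F⊆G (from (truth ρ s G) ⟦s⟧)))
    (λ s⇒t G F⊆G G∋s → from (truth ρ t G) (s⇒t G F⊆G (to (truth ρ s G) G∋s)))
    ⇔-∘ ∋-⇨⇔ F

  lawHolds : InDHA A → ∀ φ → ValidInDHA (φ , top) → ∀ ρ F → evalUp XA _⊆ₚ_ (admissible ρ) φ F
  lawHolds inDHA φ valid ρ F =
    to (truth ρ φ F) (PF.upClosed F (reflexive (Eq.sym (inDHA (φ , top) valid ρ))) (PF.hasTop F))

  separate : ∀ F G → ¬ F ⊆ₚ G → ∃ λ x → F ∋ x × ¬ G ∋ x
  separate F G F⊈G = ¬∀→⇒∃×¬ F⊈G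

  separate₂ : ∀ F G H → ¬ F ⊆ₚ G → ¬ F ⊆ₚ H → ∃ λ x → F ∋ x × ¬ G ∋ x × ¬ H ∋ x
  separate₂ F G H F⊈G F⊈H =
    let x , F∋x , G∌x = separate F G F⊈G
        y , F∋y , H∌y = separate F H F⊈H
    in x ∧ y , PF.meetCl F F∋x F∋y ,
       G∌x ∘ PF.upClosed G (x∧y≤x x y) , H∌y ∘ PF.upClosed H (x∧y≤y x y)

  filterJoin : XA → XA → Carrier → Set (PLevel A)
  filterJoin F G u = ∃₂ λ f g → F ∋ f × G ∋ g × f ∧ g ≤ u

  filterJoin-isFilter : ∀ F G → IsFilter A (filterJoin F G)
  filterJoin-isFilter F G = record
    { upClosed = λ { u≤u′ (f , g , F∋f , G∋g , fg≤u) → f , g , F∋f , G∋g , ≤-trans fg≤u u≤u′ }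
    ; hasTop   = ⊤ , ⊤ , PF.hasTop F , PF.hasTop G , maximum _
    ; meetCl   = λ { (f , g , F∋f , G∋g , fg≤u) (f′ , g′ , F∋f′ , G∋g′ , f′g′≤u′) →
                   f ∧ f′ , g ∧ g′ , PF.meetCl F F∋f F∋f′ , PF.meetCl G G∋g G∋g′ ,
                   ∧-greatest (≤-trans (∧-monotonic (x∧y≤x _ _) (x∧y≤x _ _)) fg≤u)
                              (≤-trans (∧-monotonic (x∧y≤y _ _) (x∧y≤y _ _)) f′g′≤u′) } }

  commonExtension-or-clash : ∀ F G b → (∃ λ H → F ⊆ₚ H × G ⊆ₚ H × ¬ H ∋ b) ⊎ filterJoin F G b
  commonExtension-or-clash F G b with dec (filterJoin F G b)
  ... | yes clash   = inj₂ clash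
  ... | no no-clash
    with FilterQuotient.primeFilter-extension A lem (filterJoin-isFilter F G) pft {⊤} {b}
           (no-clash ∘ FilterQuotient.⊤≤Φ⇒∈ A lem (filterJoin-isFilter F G))
  ... | H , F∨G⊆H , _ , H∌b =
    inj₁ (H , (λ x F∋x → F∨G⊆H x (x , ⊤ , F∋x , PF.hasTop G , x∧y≤x x ⊤))
            , (λ x G∋x → F∨G⊆H x (⊤ , x , PF.hasTop F , G∋x , x∧y≤y ⊤ x)) , H∌b)

  assign : Carrier → Carrier → Carrier → Carrier → ℕ → Carrier
  assign a b c d 0 = a
  assign a b c d 1 = b
  assign a b c d 2 = c
  assign a b c d 3 = d
  assign a b c d _ = ⊤

  module Cone (inDHA : InDHA A) (x₀ : XA) where
    open DHALaws lem

    infix 4 _≤₀_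
    _≤₀_ : Rel (Above _⊆ₚ_ x₀) (PLevel A)
    _≤₀_ = _≤↑_ _⊆ₚ_ x₀

    law : ∀ φ → ValidInDHA (φ , top) → ∀ a b c d → evalUp XA _⊆ₚ_ (admissible (assign a b c d)) φ x₀
    law φ valid a b c d = lawHolds inDHA φ valid (assign a b c d) x₀

    threePoint : ∀ {p q s} → Incomparable _≤₀_ p q → p ≤₀ s → ¬ s ≤₀ p → q ≤₀ s
    threePoint {P , x₀⊆P} {Q , x₀⊆Q} {S , _} (P⊈Q , Q⊈P) P⊆S S⊈P = dne λ Q⊈S →
      let c , P∋c , Q∌c = separate P Q P⊈Q
          b , Q∋b , S∌b = separate Q S Q⊈S
          a , S∋a , P∌a = separate S P S⊈P
      in case law threePointLaw threePointLaw-valid a b c ⊤ of λ where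
           (inj₂ b⇒c) → Q∌c (lower (b⇒c Q x₀⊆Q (lift Q∋b)))
           (inj₁ c⇒…) → case c⇒… P x₀⊆P (lift P∋c) of λ where
             (inj₁ (lift P∋b))        → S∌b (P⊆S b P∋b)
             (inj₂ (inj₁ (lift P∋a))) → P∌a P∋a
             (inj₂ (inj₂ a⇒b))        → S∌b (lower (a⇒b S P⊆S (lift S∋a)))

    noAntichain : ∀ {p q s} → Incomparable _≤₀_ p q → Incomparable _≤₀_ p s → ¬ Incomparable _≤₀_ q s
    noAntichain {P , x₀⊆P} {Q , x₀⊆Q} {S , x₀⊆S} (P⊈Q , Q⊈P) (P⊈S , S⊈P) (Q⊈S , S⊈Q) =
      let a , P∋a , Q∌a , S∌a = separate₂ P Q S P⊈Q P⊈S
          b , Q∋b , P∌b , S∌b = separate₂ Q P S Q⊈P Q⊈S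
          c , S∋c , P∌c , Q∌c = separate₂ S P Q S⊈P S⊈Q
      in case law boundedWidth₂ boundedWidth₂-valid a b c ⊤ of λ where
           (inj₁ a⇒b∨c)        → [ P∌b ∘ lower , P∌c ∘ lower ]′ (a⇒b∨c P x₀⊆P (lift P∋a))
           (inj₂ (inj₁ b⇒a∨c)) → [ Q∌a ∘ lower , Q∌c ∘ lower ]′ (b⇒a∨c Q x₀⊆Q (lift Q∋b))
           (inj₂ (inj₂ c⇒a∨b)) → [ S∌a ∘ lower , S∌b ∘ lower ]′ (c⇒a∨b S x₀⊆S (lift S∋c))

    isThreePointFrame : IsThreePointFrame _≤₀_
    isThreePointFrame = record
      { ≤-refl      = λ {p} → ⊆ₚ-refl {proj₁ p}
      ; ≤-trans     = λ {p} {q} {s} → ⊆ₚ-trans {proj₁ p} {proj₁ q} {proj₁ s}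
      ; threePoint  = λ {p} {q} {s} → threePoint {p} {q} {s}
      ; noAntichain = λ {p} {q} {s} → noAntichain {p} {q} {s} }

    directed : ∀ p q → ∃ λ w → p ≤₀ w × q ≤₀ w
    directed (P , x₀⊆P) (Q , x₀⊆Q) with commonExtension-or-clash P Q ⊥
    ... | inj₁ (H , P⊆H , Q⊆H , _) = (H , ⊆ₚ-trans {x₀} {P} {H} x₀⊆P P⊆H) , P⊆H , Q⊆H
    ... | inj₂ (f , g , P∋f , Q∋g , f∧g≤⊥) =
      ⊥-elim (case law weakExcludedMiddle weakExcludedMiddle-valid f ⊤ ⊤ ⊤ of λ where
        (inj₁ ¬f)  → lower (¬f P x₀⊆P (lift P∋f))
        (inj₂ ¬¬f) → lower (¬¬f Q x₀⊆Q λ H Q⊆H H∋f →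
          lift (PF.proper H (PF.upClosed H f∧g≤⊥ (PF.meetCl H (lower H∋f) (Q⊆H g Q∋g))))))

    open ThreePointFrame lem isThreePointFrame using (above-one-or-below-both)

    -- With a = a₀ ∧ g and b = b₀ ∧ h, the clash g ∧ h ≤ d ∨ e makes the premise of the diamond law
    -- true above x₀, while the separating elements a₀, b₀, d, e refute each of its four disjuncts.
    joinAvoids : ∀ {p q r s} → Incomparable _≤₀_ p q → p ≤₀ r → p ≤₀ s → q ≤₀ r → q ≤₀ s →
                 ∀ {d e} → proj₁ r ∋ d → ¬ proj₁ s ∋ d → proj₁ s ∋ e → ¬ proj₁ r ∋ e →
                 ¬ filterJoin (proj₁ p) (proj₁ q) (d ∨ e)
    joinAvoids {P , x₀⊆P} {Q , x₀⊆Q} {R , x₀⊆R} {S , x₀⊆S} (P⊈Q , Q⊈P) P⊆R P⊆S Q⊆R Q⊆S {d} {e}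
               R∋d S∌d S∋e R∌e (g , h , P∋g , Q∋h , g∧h≤d∨e)
      with separate P Q P⊈Q | separate Q P Q⊈P
    ... | a₀ , P∋a₀ , Q∌a₀ | b₀ , Q∋b₀ , P∌b₀ =
      case law diamondLaw diamondLaw-valid a b d e x₀ (⊆ₚ-refl {x₀}) a∧b⇒d∨e of λ where
        (inj₁ a⇒b)                 → P∌b₀ (PF.upClosed P (x∧y≤x _ _) (lower (a⇒b P x₀⊆P (lift P∋a))))
        (inj₂ (inj₁ b⇒a))          → Q∌a₀ (PF.upClosed Q (x∧y≤x _ _) (lower (b⇒a Q x₀⊆Q (lift Q∋b))))
        (inj₂ (inj₂ (inj₁ abd⇒e))) →
          R∌e (lower (abd⇒e R x₀⊆R ((lift (P⊆R a P∋a) , lift (Q⊆R b Q∋b)) , lift R∋d)))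
        (inj₂ (inj₂ (inj₂ abe⇒d))) →
          S∌d (lower (abe⇒d S x₀⊆S ((lift (P⊆S a P∋a) , lift (Q⊆S b Q∋b)) , lift S∋e)))
      where
      a b : Carrier
      a = a₀ ∧ g
      b = b₀ ∧ h
      P∋a : P ∋ a
      P∋a = PF.meetCl P P∋a₀ P∋g
      Q∋b : Q ∋ b
      Q∋b = PF.meetCl Q Q∋b₀ Q∋h
      a∧b⇒d∨e : evalUp XA _⊆ₚ_ (admissible (assign a b d e)) ((p₀ and p₁) imp (p₂ or p₃)) x₀
      a∧b⇒d∨e W _ (lift W∋a , lift W∋b) = Sum.map lift lift (PF.prime W
        (PF.upClosed W (≤-trans (∧-monotonic (x∧y≤y _ _) (x∧y≤y _ _)) g∧h≤d∨e) (PF.meetCl W W∋a W∋b)))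

    interpolate : ∀ {p q r s} → Incomparable _≤₀_ p q → Incomparable _≤₀_ r s →
                  p ≤₀ r → p ≤₀ s → q ≤₀ r → q ≤₀ s → ∃ λ w → p ≤₀ w × q ≤₀ w × w ≤₀ r × w ≤₀ s
    interpolate {p@(P , x₀⊆P)} {q@(Q , _)} {r@(R , _)} {s@(S , _)} p∥q r∥s P⊆R P⊆S Q⊆R Q⊆S
      with separate R S (proj₁ r∥s) | separate S R (proj₂ r∥s)
    ... | d , R∋d , S∌d | e , S∋e , R∌e with commonExtension-or-clash P Q (d ∨ e)
    ... | inj₂ clash = ⊥-elim (joinAvoids {p} {q} {r} {s} p∥q P⊆R P⊆S Q⊆R Q⊆S R∋d S∌d S∋e R∌e clash)
    ... | inj₁ (H , P⊆H , Q⊆H , H∌d∨e)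
      with above-one-or-below-both {r} {s} (H , ⊆ₚ-trans {x₀} {P} {H} x₀⊆P P⊆H) r∥s
    ... | inj₁ R⊆H                = ⊥-elim (H∌d∨e (PF.upClosed H (x≤x∨y d e) (R⊆H d R∋d)))
    ... | inj₂ (inj₁ S⊆H)         = ⊥-elim (H∌d∨e (PF.upClosed H (y≤x∨y d e) (S⊆H e S∋e)))
    ... | inj₂ (inj₂ (H⊆R , H⊆S)) = (H , ⊆ₚ-trans {x₀} {P} {H} x₀⊆P P⊆H) , P⊆H , Q⊆H , H⊆R , H⊆S

    isDiamondFrame : IsDiamondFrame _≤₀_
    isDiamondFrame = record
      { isThreePointFrame = isThreePointFrame
      ; directed          = directed
      ; interpolate       = λ {p} {q} {r} {s} → interpolate {p} {q} {r} {s} }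

theorem7p3 : (lem : (ℓ : Level) → ExcludedMiddle ℓ) →
             ∀ {c ℓ₁ ℓ₂} → PrimeFilterTheorem c ℓ₁ ℓ₂ →
             (A : HeytingAlgebra c ℓ₁ ℓ₂) → InDHA A →
             UpInDHA (PrimeFilter A) (_⊆PF_ A)
theorem7p3 lem pft A inDHA =
  diamondCones⇒UpInDHA lem (λ {F} → ⊆ₚ-refl {F}) (λ {F} {G} {H} → ⊆ₚ-trans {F} {G} {H})
                       (Cone.isDiamondFrame inDHA)
  where open PrimeFilterFrame lem pft A
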